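{- Let $G=(V,E)$ be a fork-free graph and $I,J$ independent sets of $G$ of the same size, such that no vertex of $G$ is adjacent to three or more vertices of $I$, and such that there is no non-trivial module $M$ of $G$ with $M\cap I=\{u\}$, $M\cap J=\{v\}$ and $u,v$ in distinct connected components of $G[M]$. Let $M$ be a non-trivial module of $G$. (a) If $|M\cap I|\le 1$: if $|M\cap J|\le 1$ then $I\leftrightsquigarrow J$ in $G$ iff $I_M\leftrightsquigarrow J_M$ in $G_M$; if $|M\cap J|\ge 2$ then there is no TS-reconfiguration sequence from $I$ to $J$. (b) If $|M\cap I|\ge 2$: if $|M\cap J|\neq |M\cap I|$ then there is no TS-reconfiguration sequence from $I$ to $J$; otherwise $I\leftrightsquigarrow J$ in $G$ iff $I\leftrightsquigarrow J$ in $G-(N(M)\setminus M)$.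
   Context: A module is a set $M\subseteq V$ such that each vertex outside $M$ is adjacent to all or none of $M$; non-trivial means $M\ne\emptyset$, $M\neq V$. $N(M)$ is the set of vertices adjacent to some vertex of $M$. A fork is the claw with one edge subdivided once. Two independent sets $A,B$ are TS-adjacent if $A\setminus B=\{x\}$, $B\setminus A=\{y\}$ and $xy\in E$; $A\leftrightsquigarrow B$ means there is a TS-reconfiguration sequence from $A$ to $B$. For a module $M$ with $|M\cap I|\le1$ and $|M\cap J|\le1$, $G_M$ is obtained from $G$ by replacing $M$ by one new vertex $m$ adjacent to exactly the vertices of $V\setminus M$ adjacent to $M$; $I_M=(I\setminus M)\cup\{m\}$ if $|I\cap M|=1$ and $I_M=I\setminus M$ otherwise; similarly $J_M$. -}

module Defs where

open import Data.Nat using (ℕ; zero; suc; _≤_)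
open import Data.Nat.Base using (_≡ᵇ_)
open import Data.Bool using (Bool; true; false; _∧_; _∨_; not; if_then_else_)
open import Data.Fin using (Fin; zero; suc)
open import Data.Fin.Subset using (Subset; _∈_; _∉_; _⊆_; ⁅_⁆; _∩_; _∪_; _─_; ∁; ∣_∣)
open import Data.Vec using (Vec; []; _∷_; lookup; tabulate)
open import Data.Product using (Σ; ∃; _×_; _,_)
open import Data.Sum using (_⊎_)
open import Relation.Binary.PropositionalEquality using (_≡_; _≢_)
open import Relation.Nullary using (¬_)

-- Only adjacencies between
-- vertices of V are relevant.  (Symmetry/irreflexivity are assumed as
-- hypotheses where needed.)
record Graph (n : ℕ) : Set where
  constructor graph
  field
    V   : Subset n
    adj : Fin n → Fin n → Bool

open Graph public

module _ {n : ℕ} where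

  Adj : Graph n → Fin n → Fin n → Set
  Adj G x y = adj G x y ≡ true

  Simple : Graph n → Set
  Simple G = (∀ x y → adj G x y ≡ adj G y x) × (∀ x → adj G x x ≡ false)

  anyᵇ : ∀ {k} → (Fin k → Bool) → Bool
  anyᵇ {zero}  f = false
  anyᵇ {suc k} f = f zero ∨ anyᵇ (λ i → f (suc i))

  Independent : Graph n → Subset n → Set
  Independent G A = A ⊆ V G × (∀ x y → x ∈ A → y ∈ A → ¬ Adj G x y)

  TSAdj : Graph n → Subset n → Subset n → Set
  TSAdj G A B = Σ (Fin n) λ x → Σ (Fin n) λ y →
    (A ─ B ≡ ⁅ x ⁆) × (B ─ A ≡ ⁅ y ⁆) × Adj G x y

  data TSReach (G : Graph n) : Subset n → Subset n → Set where
    done : ∀ {A} → Independent G A → TSReach G A A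
    step : ∀ {A B C} → Independent G A → TSAdj G A B → TSReach G B C → TSReach G A C

  data PathIn (G : Graph n) (S : Subset n) : Fin n → Fin n → Set where
    here  : ∀ {u} → u ∈ S → PathIn G S u u
    there : ∀ {u w v} → u ∈ S → Adj G u w → PathIn G S w v → PathIn G S u v

  IsModule : Graph n → Subset n → Set
  IsModule G M = M ⊆ V G ×
    (∀ y → y ∈ V G → y ∉ M →
      (∀ x → x ∈ M → adj G x y ≡ true) ⊎ (∀ x → x ∈ M → adj G x y ≡ false))

  NonTrivialModule : Graph n → Subset n → Set
  NonTrivialModule G M = IsModule G M × (∃ λ x → x ∈ M) × (∃ λ y → y ∈ V G × y ∉ M)

  IsFork : Graph n → Fin n → Fin n → Fin n → Fin n → Fin n → Set
  IsFork G a b c d e =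
    (a ∈ V G × b ∈ V G × c ∈ V G × d ∈ V G × e ∈ V G) ×
    (a ≢ b × a ≢ c × a ≢ d × a ≢ e × b ≢ c × b ≢ d × b ≢ e × c ≢ d × c ≢ e × d ≢ e) ×
    (Adj G a b × Adj G a c × Adj G a d × Adj G d e) ×
    (¬ Adj G b c × ¬ Adj G b d × ¬ Adj G c d × ¬ Adj G a e × ¬ Adj G b e × ¬ Adj G c e)

  ForkFree : Graph n → Set
  ForkFree G = ∀ a b c d e → ¬ IsFork G a b c d e

  NoVertexSeesThree : Graph n → Subset n → Set
  NoVertexSeesThree G I = ∀ v x y z → v ∈ V G → x ∈ I → y ∈ I → z ∈ I →
    x ≢ y → x ≢ z → y ≢ z → ¬ (Adj G v x × Adj G v y × Adj G v z)

  NoSplitModule : Graph n → Subset n → Subset n → Set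
  NoSplitModule G I J = ∀ M u v → NonTrivialModule G M →
    M ∩ I ≡ ⁅ u ⁆ → M ∩ J ≡ ⁅ v ⁆ → ¬ ¬ PathIn G M u v

  Nbhd : Graph n → Subset n → Subset n
  Nbhd G M = tabulate λ y → lookup (V G) y ∧ anyᵇ (λ x → lookup M x ∧ adj G x y)

  deleteV : Graph n → Subset n → Graph n
  deleteV G X = graph (V G ─ X) (adj G)

  -- G_M : M replaced by a new vertex m (= zero); old vertex x becomes suc x
  contract : Graph n → Subset n → Graph (suc n)
  contract G M = graph (true ∷ (V G ─ M)) adj'
    where
      mAdj : Fin n → Bool
      mAdj y = lookup (Nbhd G M) y ∧ not (lookup M y)
      adj' : Fin (suc n) → Fin (suc n) → Bool
      adj' zero    zero    = false
      adj' zero    (suc y) = mAdj y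
      adj' (suc x) zero    = mAdj x
      adj' (suc x) (suc y) = adj G x y

  contractSet : Subset n → Subset n → Subset (suc n)
  contractSet M I = (∣ I ∩ M ∣ ≡ᵇ 1) ∷ (I ─ M)

{-# OPTIONS --safe #-}
module Submission where

open import Defs
open import Data.Bool using (Bool; true; false; _∧_; not)
open import Data.Bool.Properties using (∧-conicalˡ; ∧-conicalʳ; ¬-not) renaming (_≟_ to _≟ᵇ_)
open import Data.Fin using (Fin; zero; suc) renaming (_≟_ to _≟ᶠ_)
open import Data.Fin.Properties using (any?)
open import Data.Fin.Subset using (Subset; _∩_; _∪_; _─_; _-_; ∣_∣; ⊤; ⊥; ⁅_⁆; _∈_; _∉_; _⊆_; Nonempty)
open import Data.Fin.Subset.Properties
  using (_∈?_; ∈⊤; ∉⊥; drop-there; x∈⁅x⁆; x∈⁅y⁆⇒x≡y; ∣⊥∣≡0; ∣⁅x⁆∣≡1; ⊆-antisym; Empty-unique; nonempty?;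
         ∩-comm; x∈p∩q⁺; x∈p∩q⁻; x∈p∪q⁺; x∈p∪q⁻; x∈p∧x∉q⇒x∈p─q; x∈p∧x≢y⇒x∈p-y; p─q⊆p; x∈p⇒∣p-x∣<∣p∣)
open import Data.Nat using (ℕ; zero; suc; _≤_; _<_; _+_; _≡ᵇ_; s≤s; z≤n)
open import Data.Nat.Properties using (+-suc; +-cancelʳ-≡; ≤-trans; ≤-pred; ≤-refl; ≤-reflexive; n≤0⇒n≡0; n≮0; >⇒≢)
open import Data.Product using (∃; ∃₂; _×_; _,_; proj₁; proj₂)
open import Data.Sum using (_⊎_; inj₁; inj₂; [_,_]′)
open import Data.Vec using (_∷_; []; lookup; here; there)
open import Data.Vec.Properties using ([]=⇒lookup; lookup⇒[]=; lookup∘tabulate; lookup-replicate; ∷-injectiveʳ)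
open import Function using (_∘_; id)
open import Relation.Binary.PropositionalEquality
open import Relation.Nullary using (¬_; Dec; yes; no; contradiction)
open import Relation.Nullary.Decidable using (_×-dec_; decidable-stable)

-- Call the vertices of an independent set tokens.  A token crossing the boundary of M moves
-- along an edge between M and N(M) ∖ M, and the outer endpoint then sees all of M; by
-- independence M holds no other token at that moment.  So a move changes |M ∩ A| only
-- between 0 and 1: |M ∩ A| ≤ 1 is invariant, |M ∩ A| ≥ 2 never changes, and in the latter
-- case no token ever sits on N(M) ∖ M, which gives (b).  With at most one token in M,
-- contraction maps each move either to a move of G_M or, inside M, to nothing.  Conversely a
-- sequence in G_M lifts move by move, a token entering M being placed at the vertex of J's
-- token; at the end the only possible discrepancy, one token at different vertices of M, is
-- removed by sliding it along a path of G[M], which the split-module hypothesis provides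
-- (up to a double negation, removed since paths in a finite graph are decidable).

x∈p─q⇒x∉q : ∀ {n} {p q : Subset n} {x} → x ∈ p ─ q → x ∉ q
x∈p─q⇒x∉q {p = true ∷ p} {false ∷ q} here ()
x∈p─q⇒x∉q {p = _ ∷ p} {_ ∷ q} (there x∈p─q) (there x∈q) = x∈p─q⇒x∉q x∈p─q x∈q

∣p∣+∣q─p∣≡∣q∣+∣p─q∣ : ∀ {n} (p q : Subset n) → ∣ p ∣ + ∣ q ─ p ∣ ≡ ∣ q ∣ + ∣ p ─ q ∣
∣p∣+∣q─p∣≡∣q∣+∣p─q∣ []          []          = refl
∣p∣+∣q─p∣≡∣q∣+∣p─q∣ (true ∷ p)  (true ∷ q)  = cong suc (∣p∣+∣q─p∣≡∣q∣+∣p─q∣ p q)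
∣p∣+∣q─p∣≡∣q∣+∣p─q∣ (true ∷ p)  (false ∷ q) = trans (cong suc (∣p∣+∣q─p∣≡∣q∣+∣p─q∣ p q)) (sym (+-suc _ _))
∣p∣+∣q─p∣≡∣q∣+∣p─q∣ (false ∷ p) (true ∷ q)  = trans (+-suc _ _) (cong suc (∣p∣+∣q─p∣≡∣q∣+∣p─q∣ p q))
∣p∣+∣q─p∣≡∣q∣+∣p─q∣ (false ∷ p) (false ∷ q) = ∣p∣+∣q─p∣≡∣q∣+∣p─q∣ p q

module _ {n : ℕ} where

  ∈-≡⁅x⁆ : ∀ {p : Subset n} {x} → p ≡ ⁅ x ⁆ → x ∈ p
  ∈-≡⁅x⁆ {x = x} refl = x∈⁅x⁆ x

  ⁅x⁆-unique : ∀ {p : Subset n} {x} → x ∈ p → (∀ {y} → y ∈ p → y ≡ x) → p ≡ ⁅ x ⁆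
  ⁅x⁆-unique {p} {x} x∈p only = ⊆-antisym
    (λ y∈p → subst (_∈ ⁅ x ⁆) (sym (only y∈p)) (x∈⁅x⁆ x))
    (λ y∈⁅x⁆ → subst (_∈ p) (sym (x∈⁅y⁆⇒x≡y x y∈⁅x⁆)) x∈p)

  ∣p∣≡0⇒p≡⊥ : ∀ {p : Subset n} → ∣ p ∣ ≡ 0 → p ≡ ⊥
  ∣p∣≡0⇒p≡⊥ {p} ∣p∣≡0 = Empty-unique λ (x , x∈p) → n≮0 (subst (∣ p - x ∣ <_) ∣p∣≡0 (x∈p⇒∣p-x∣<∣p∣ x∈p))

  0<∣p∣⇒Nonempty : ∀ {p : Subset n} → 0 < ∣ p ∣ → Nonempty p
  0<∣p∣⇒Nonempty {p} 0<∣p∣ with nonempty? p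
  ... | yes nonempty = nonempty
  ... | no empty = contradiction (trans (cong ∣_∣ (Empty-unique empty)) (∣⊥∣≡0 n)) (>⇒≢ 0<∣p∣)

  ∣p∣≤1⇒p≡⁅x⁆ : ∀ {p : Subset n} {x} → ∣ p ∣ ≤ 1 → x ∈ p → p ≡ ⁅ x ⁆
  ∣p∣≤1⇒p≡⁅x⁆ {p} {x} ∣p∣≤1 x∈p = ⁅x⁆-unique x∈p only
    where
    p-x≡⊥ : p - x ≡ ⊥
    p-x≡⊥ = ∣p∣≡0⇒p≡⊥ (n≤0⇒n≡0 (≤-pred (≤-trans (x∈p⇒∣p-x∣<∣p∣ x∈p) ∣p∣≤1)))
    only : ∀ {y} → y ∈ p → y ≡ x
    only {y} y∈p with y ≟ᶠ x
    ... | yes y≡x = y≡x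
    ... | no y≢x = contradiction (subst (y ∈_) p-x≡⊥ (x∈p∧x≢y⇒x∈p-y y∈p y≢x)) ∉⊥

  ∣p∣≤1⇒p≡⊥⊎p≡⁅x⁆ : ∀ {p : Subset n} → ∣ p ∣ ≤ 1 → p ≡ ⊥ ⊎ ∃ λ x → p ≡ ⁅ x ⁆
  ∣p∣≤1⇒p≡⊥⊎p≡⁅x⁆ {p} ∣p∣≤1 with nonempty? p
  ... | yes (x , x∈p) = inj₂ (x , ∣p∣≤1⇒p≡⁅x⁆ ∣p∣≤1 x∈p)
  ... | no empty = inj₁ (Empty-unique empty)

  p≡⊥⇒∣p∣≡0 : ∀ {p : Subset n} → p ≡ ⊥ → ∣ p ∣ ≡ 0
  p≡⊥⇒∣p∣≡0 refl = ∣⊥∣≡0 n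

  p≡⁅x⁆⇒∣p∣≡1 : ∀ {p : Subset n} {x} → p ≡ ⁅ x ⁆ → ∣ p ∣ ≡ 1
  p≡⁅x⁆⇒∣p∣≡1 {x = x} refl = ∣⁅x⁆∣≡1 x

  ∩-─-ext : ∀ {p q r : Subset n} → q ∩ p ≡ q ∩ r → p ─ q ≡ r ─ q → p ≡ r
  ∩-─-ext q∩p≡q∩r p─q≡r─q = ⊆-antisym (covered q∩p≡q∩r p─q≡r─q) (covered (sym q∩p≡q∩r) (sym p─q≡r─q))
    where
    covered : ∀ {p q r : Subset n} → q ∩ p ≡ q ∩ r → p ─ q ≡ r ─ q → p ⊆ r
    covered {p} {q} {r} q∩p≡q∩r p─q≡r─q {z} z∈p with z ∈? q
    ... | yes z∈q = proj₂ (x∈p∩q⁻ q r (subst (z ∈_) q∩p≡q∩r (x∈p∩q⁺ (z∈q , z∈p))))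
    ... | no z∉q  = p─q⊆p r q (subst (z ∈_) p─q≡r─q (x∈p∧x∉q⇒x∈p─q z∈p z∉q))

  record Swap (A B : Subset n) (x y : Fin n) : Set where
    field
      x∈A   : x ∈ A
      x∉B   : x ∉ B
      y∈B   : y ∈ B
      y∉A   : y ∉ A
      A-x⊆B : ∀ {z} → z ∈ A → z ≢ x → z ∈ B
      B-y⊆A : ∀ {z} → z ∈ B → z ≢ y → z ∈ A

  private variable
    A B C M : Subset n
    x y : Fin n

  Swap-sym : Swap A B x y → Swap B A y x
  Swap-sym s = record
    { x∈A = y∈B ; x∉B = y∉A ; y∈B = x∈A ; y∉A = x∉B ; A-x⊆B = B-y⊆A ; B-y⊆A = A-x⊆B }
    where open Swap s

  Swap-unique : Swap A B x y → Swap A C x y → B ≡ C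
  Swap-unique {x = x} {y = y} s t = ⊆-antisym (moved s t) (moved t s)
    where
    moved : ∀ {A B C} → Swap A B x y → Swap A C x y → B ⊆ C
    moved s t {z} z∈B with z ≟ᶠ y
    ... | yes refl = Swap.y∈B t
    ... | no z≢y   = Swap.A-x⊆B t (Swap.B-y⊆A s z∈B z≢y) λ { refl → Swap.x∉B s z∈B }

  Swap⇒─≡⁅x⁆ : Swap A B x y → A ─ B ≡ ⁅ x ⁆
  Swap⇒─≡⁅x⁆ {A = A} {B = B} {x = x} s = ⁅x⁆-unique (x∈p∧x∉q⇒x∈p─q x∈A x∉B) only
    where
    open Swap s
    only : ∀ {z} → z ∈ A ─ B → z ≡ x
    only {z} z∈A─B with z ≟ᶠ x
    ... | yes z≡x = z≡x
    ... | no z≢x  = contradiction (A-x⊆B (p─q⊆p A B z∈A─B) z≢x) (x∈p─q⇒x∉q z∈A─B)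

  ─≡⁅⁆⇒Swap : A ─ B ≡ ⁅ x ⁆ → B ─ A ≡ ⁅ y ⁆ → Swap A B x y
  ─≡⁅⁆⇒Swap {A = A} {B = B} {x = x} {y = y} A─B≡x B─A≡y = record
    { x∈A = p─q⊆p A B x∈A─B ; x∉B = x∈p─q⇒x∉q x∈A─B
    ; y∈B = p─q⊆p B A y∈B─A ; y∉A = x∈p─q⇒x∉q y∈B─A
    ; A-x⊆B = kept A─B≡x ; B-y⊆A = kept B─A≡y }
    where
    x∈A─B : x ∈ A ─ B
    x∈A─B = subst (x ∈_) (sym A─B≡x) (x∈⁅x⁆ x)
    y∈B─A : y ∈ B ─ A
    y∈B─A = subst (y ∈_) (sym B─A≡y) (x∈⁅x⁆ y)
    kept : ∀ {P Q : Subset n} {w z} → P ─ Q ≡ ⁅ w ⁆ → z ∈ P → z ≢ w → z ∈ Q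
    kept {P} {Q} {w} {z} P─Q≡w z∈P z≢w with z ∈? Q
    ... | yes z∈Q = z∈Q
    ... | no z∉Q  = contradiction (x∈⁅y⁆⇒x≡y w (subst (z ∈_) P─Q≡w (x∈p∧x∉q⇒x∈p─q z∈P z∉Q))) z≢w

  Swap-∣∣ : Swap A B x y → ∣ A ∣ ≡ ∣ B ∣
  Swap-∣∣ {A = A} {B = B} s = +-cancelʳ-≡ 1 ∣ A ∣ ∣ B ∣ (begin
    ∣ A ∣ + 1          ≡⟨ cong (∣ A ∣ +_) (sym (p≡⁅x⁆⇒∣p∣≡1 (Swap⇒─≡⁅x⁆ (Swap-sym s)))) ⟩
    ∣ A ∣ + ∣ B ─ A ∣  ≡⟨ ∣p∣+∣q─p∣≡∣q∣+∣p─q∣ A B ⟩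
    ∣ B ∣ + ∣ A ─ B ∣  ≡⟨ cong (∣ B ∣ +_) (p≡⁅x⁆⇒∣p∣≡1 (Swap⇒─≡⁅x⁆ s)) ⟩
    ∣ B ∣ + 1          ∎)
    where open ≡-Reasoning

  Swap-⁅⁆ : Swap A B x y → A ≡ ⁅ x ⁆ → B ≡ ⁅ y ⁆
  Swap-⁅⁆ {B = B} {x = x} {y = y} s A≡x = ⁅x⁆-unique y∈B only
    where
    open Swap s
    only : ∀ {z} → z ∈ B → z ≡ y
    only {z} z∈B with z ≟ᶠ y
    ... | yes z≡y = z≡y
    ... | no z≢y  = contradiction (subst (_∈ B) (x∈⁅y⁆⇒x≡y x (subst (z ∈_) A≡x (B-y⊆A z∈B z≢y))) z∈B) x∉B

  swap : Subset n → Fin n → Fin n → Subset n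
  swap A x y = (A - x) ∪ ⁅ y ⁆

  swap-Swap : x ∈ A → y ∉ A → Swap A (swap A x y) x y
  swap-Swap {x = x} {A = A} {y = y} x∈A y∉A = record
    { x∈A = x∈A
    ; x∉B = [ (λ x∈A-x → x∈p─q⇒x∉q x∈A-x (x∈⁅x⁆ x)) , (λ x∈⁅y⁆ → y∉A (subst (_∈ A) (x∈⁅y⁆⇒x≡y y x∈⁅y⁆) x∈A)) ]′
            ∘ x∈p∪q⁻ (A - x) ⁅ y ⁆
    ; y∈B = x∈p∪q⁺ (inj₂ (x∈⁅x⁆ y))
    ; y∉A = y∉A
    ; A-x⊆B = λ z∈A z≢x → x∈p∪q⁺ (inj₁ (x∈p∧x≢y⇒x∈p-y z∈A z≢x))
    ; B-y⊆A = λ z∈B z≢y → [ p─q⊆p A ⁅ x ⁆ , (λ z∈⁅y⁆ → contradiction (x∈⁅y⁆⇒x≡y y z∈⁅y⁆) z≢y) ]′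
                            (x∈p∪q⁻ (A - x) ⁅ y ⁆ z∈B) }

  Swap-∩ : Swap A B x y → x ∈ M → y ∈ M → Swap (M ∩ A) (M ∩ B) x y
  Swap-∩ s x∈M y∈M = record
    { x∈A = x∈p∩q⁺ (x∈M , x∈A) ; x∉B = x∉B ∘ proj₂ ∘ x∈p∩q⁻ _ _
    ; y∈B = x∈p∩q⁺ (y∈M , y∈B) ; y∉A = y∉A ∘ proj₂ ∘ x∈p∩q⁻ _ _
    ; A-x⊆B = λ z∈ z≢x → let (z∈M , z∈A) = x∈p∩q⁻ _ _ z∈ in x∈p∩q⁺ (z∈M , A-x⊆B z∈A z≢x)
    ; B-y⊆A = λ z∈ z≢y → let (z∈M , z∈B) = x∈p∩q⁻ _ _ z∈ in x∈p∩q⁺ (z∈M , B-y⊆A z∈B z≢y) }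
    where open Swap s

  Swap-─ : Swap A B x y → x ∉ M → y ∉ M → Swap (A ─ M) (B ─ M) x y
  Swap-─ s x∉M y∉M = record
    { x∈A = x∈p∧x∉q⇒x∈p─q x∈A x∉M ; x∉B = x∉B ∘ p─q⊆p _ _
    ; y∈B = x∈p∧x∉q⇒x∈p─q y∈B y∉M ; y∉A = y∉A ∘ p─q⊆p _ _
    ; A-x⊆B = λ z∈ z≢x → x∈p∧x∉q⇒x∈p─q (A-x⊆B (p─q⊆p _ _ z∈) z≢x) (x∈p─q⇒x∉q z∈)
    ; B-y⊆A = λ z∈ z≢y → x∈p∧x∉q⇒x∈p─q (B-y⊆A (p─q⊆p _ _ z∈) z≢y) (x∈p─q⇒x∉q z∈) }
    where open Swap s

  Swap⇒∩≡ : Swap A B x y → x ∉ M → y ∉ M → M ∩ A ≡ M ∩ B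
  Swap⇒∩≡ s x∉M y∉M = ⊆-antisym (kept s x∉M) (kept (Swap-sym s) y∉M)
    where
    kept : ∀ {A B x y} → Swap A B x y → x ∉ M → M ∩ A ⊆ M ∩ B
    kept s x∉M z∈ = let (z∈M , z∈A) = x∈p∩q⁻ _ _ z∈ in
      x∈p∩q⁺ (z∈M , Swap.A-x⊆B s z∈A λ { refl → x∉M z∈M })

  Swap⇒─≡ : Swap A B x y → x ∈ M → y ∈ M → A ─ M ≡ B ─ M
  Swap⇒─≡ s x∈M y∈M = ⊆-antisym (kept s x∈M) (kept (Swap-sym s) y∈M)
    where
    kept : ∀ {A B x y} → Swap A B x y → x ∈ M → A ─ M ⊆ B ─ M
    kept s x∈M z∈ = x∈p∧x∉q⇒x∈p─q (Swap.A-x⊆B s (p─q⊆p _ _ z∈) λ { refl → x∈p─q⇒x∉q z∈ x∈M }) (x∈p─q⇒x∉q z∈)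

  Swap-∩-entering : Swap A B x y → y ∈ M → M ∩ A ≡ ⊥ → M ∩ B ≡ ⁅ y ⁆
  Swap-∩-entering {B = B} {y = y} {M = M} s y∈M M∩A≡⊥ = ⁅x⁆-unique (x∈p∩q⁺ (y∈M , y∈B)) only
    where
    open Swap s
    only : ∀ {z} → z ∈ M ∩ B → z ≡ y
    only {z} z∈ with z ≟ᶠ y
    ... | yes z≡y = z≡y
    ... | no z≢y  = let (z∈M , z∈B) = x∈p∩q⁻ _ _ z∈ in
                    contradiction (subst (z ∈_) M∩A≡⊥ (x∈p∩q⁺ (z∈M , B-y⊆A z∈B z≢y))) ∉⊥

  Swap-∩-leaving : Swap A B x y → y ∉ M → M ∩ A ≡ ⁅ x ⁆ → M ∩ B ≡ ⊥
  Swap-∩-leaving {x = x} s y∉M M∩A≡x = Empty-unique λ (z , z∈) →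
    let (z∈M , z∈B) = x∈p∩q⁻ _ _ z∈
        z≡x = x∈⁅y⁆⇒x≡y x (subst (z ∈_) M∩A≡x (x∈p∩q⁺ (z∈M , B-y⊆A z∈B λ { refl → y∉M z∈M })))
    in x∉B (subst (_∈ _) z≡x z∈B)
    where open Swap s

Swap-∷ : ∀ {n} {A B : Subset n} {x y b} → Swap A B x y → Swap (b ∷ A) (b ∷ B) (suc x) (suc y)
Swap-∷ s = record
  { x∈A = there x∈A ; x∉B = x∉B ∘ drop-there ; y∈B = there y∈B ; y∉A = y∉A ∘ drop-there
  ; A-x⊆B = ∷-kept A-x⊆B ; B-y⊆A = ∷-kept B-y⊆A }
  where
  open Swap s
  ∷-kept : ∀ {n} {A B : Subset n} {x b} → (∀ {z} → z ∈ A → z ≢ x → z ∈ B) →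
           ∀ {z} → z ∈ b ∷ A → z ≢ suc x → z ∈ b ∷ B
  ∷-kept kept here        _   = here
  ∷-kept kept (there z∈A) z≢x = there (kept z∈A (z≢x ∘ cong suc))

module _ {n : ℕ} {G : Graph n} where

  private variable
    A B C : Subset n
    x y : Fin n

  nonadjacent : Independent G A → x ∈ A → y ∈ A → ¬ Adj G x y
  nonadjacent iA = proj₂ iA _ _

  TSAdj⇒Swap : TSAdj G A B → ∃₂ λ x y → Swap A B x y × Adj G x y
  TSAdj⇒Swap (x , y , A─B≡x , B─A≡y , xy) = x , y , ─≡⁅⁆⇒Swap A─B≡x B─A≡y , xy

  Swap⇒TSAdj : Swap A B x y → Adj G x y → TSAdj G A B
  Swap⇒TSAdj s xy = _ , _ , Swap⇒─≡⁅x⁆ s , Swap⇒─≡⁅x⁆ (Swap-sym s) , xy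

  TSReach-independent : TSReach G A C → Independent G A
  TSReach-independent (done iA)     = iA
  TSReach-independent (step iA _ _) = iA

  module _ {X : Subset n} where

    Independent-deleteV : Independent G A → (∀ {z} → z ∈ A → z ∉ X) → Independent (deleteV G X) A
    Independent-deleteV (A⊆V , nonadj) avoids = (λ z∈A → x∈p∧x∉q⇒x∈p─q (A⊆V z∈A) (avoids z∈A)) , nonadj

    Independent-deleteV⁻ : Independent (deleteV G X) A → Independent G A
    Independent-deleteV⁻ (A⊆V─X , nonadj) = (λ z∈A → p─q⊆p _ _ (A⊆V─X z∈A)) , nonadj

    reach-deleteV⇒reach : TSReach (deleteV G X) A C → TSReach G A C
    reach-deleteV⇒reach (done iA)     = done (Independent-deleteV⁻ iA)
    reach-deleteV⇒reach (step iA t r) = step (Independent-deleteV⁻ iA) t (reach-deleteV⇒reach r)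

  PathIn-start : ∀ {S u v} → PathIn G S u v → u ∈ S
  PathIn-start (here u∈S)      = u∈S
  PathIn-start (there u∈S _ _) = u∈S

  PathIn-mono : ∀ {S T u v} → S ⊆ T → PathIn G S u v → PathIn G T u v
  PathIn-mono S⊆T (here u∈S)       = here (S⊆T u∈S)
  PathIn-mono S⊆T (there u∈S uw p) = there (S⊆T u∈S) uw (PathIn-mono S⊆T p)

  -- Either the path avoids u, or its suffix after the last visit of u does.
  PathIn-avoiding : ∀ {S x v} u → u ≢ v → PathIn G S x v →
                    PathIn G (S - u) x v ⊎ ∃ λ w → Adj G u w × PathIn G (S - u) w v
  PathIn-avoiding u u≢v (here v∈S) = inj₁ (here (x∈p∧x≢y⇒x∈p-y v∈S (u≢v ∘ sym)))
  PathIn-avoiding u u≢v (there {x} x∈S xw p) with PathIn-avoiding u u≢v p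
  ... | inj₂ suffix = inj₂ suffix
  ... | inj₁ p′ with x ≟ᶠ u
  ...   | yes refl = inj₂ (_ , xw , p′)
  ...   | no x≢u   = inj₁ (there (x∈p∧x≢y⇒x∈p-y x∈S x≢u) xw p′)

  PathIn-first-step : ∀ {S u v} → u ≢ v → PathIn G S u v → ∃ λ w → Adj G u w × PathIn G (S - u) w v
  PathIn-first-step u≢v (here _)        = contradiction refl u≢v
  PathIn-first-step u≢v (there _ uw p)  = [ (λ p′ → _ , uw , p′) , id ]′ (PathIn-avoiding _ u≢v p)

  PathIn?′ : ∀ k S → ∣ S ∣ ≤ k → ∀ u v → Dec (PathIn G S u v)
  PathIn?′ k S ∣S∣≤k u v with u ∈? S | u ≟ᶠ v
  ... | no u∉S  | _        = no (u∉S ∘ PathIn-start)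
  ... | yes u∈S | yes refl = yes (here u∈S)
  PathIn?′ zero S ∣S∣≤0 u v | yes u∈S | no _ = contradiction (≤-trans (x∈p⇒∣p-x∣<∣p∣ u∈S) ∣S∣≤0) λ ()
  PathIn?′ (suc k) S ∣S∣≤1+k u v | yes u∈S | no u≢v
    with any? (λ w → (adj G u w ≟ᵇ true)
                     ×-dec PathIn?′ k (S - u) (≤-pred (≤-trans (x∈p⇒∣p-x∣<∣p∣ u∈S) ∣S∣≤1+k)) w v)
  ... | yes (w , uw , p) = yes (there u∈S uw (PathIn-mono (p─q⊆p S ⁅ u ⁆) p))
  ... | no ∄w            = no (∄w ∘ PathIn-first-step u≢v)

  PathIn-stable : ∀ {S u v} → ¬ ¬ PathIn G S u v → PathIn G S u v
  PathIn-stable {S} {u} {v} = decidable-stable (PathIn?′ ∣ S ∣ S ≤-refl u v)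

-- anyᵇ carries the unused size parameter of the module that defines it.
anyᵇ⁺ : ∀ {m k} {f : Fin k → Bool} i → f i ≡ true → anyᵇ {m} f ≡ true
anyᵇ⁺ {f = f} zero fi rewrite fi = refl
anyᵇ⁺ {m} {f = f} (suc i) fi with f zero
... | true  = refl
... | false = anyᵇ⁺ {m} i fi

anyᵇ⁻ : ∀ {m k} {f : Fin k → Bool} → anyᵇ {m} f ≡ true → ∃ λ i → f i ≡ true
anyᵇ⁻ {m} {suc k} {f} any with f zero in f0
... | true  = zero , f0
... | false = let (i , fi) = anyᵇ⁻ {m} any in suc i , fi

module ModuleReconfiguration {n : ℕ} (a : Fin n → Fin n → Bool) (simple : Simple (graph ⊤ a))
                             (M : Subset n) (M-module : IsModule (graph ⊤ a) M) where

  G : Graph n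
  G = graph ⊤ a

  G′ : Graph (suc n)
  G′ = contract G M

  N∖M : Subset n
  N∖M = Nbhd G M ─ M

  private variable
    A B C : Subset n
    w x y z : Fin n

  Adj-sym : Adj G x y → Adj G y x
  Adj-sym {x} {y} xy = trans (proj₁ simple y x) xy

  Adj-irrefl : ¬ Adj G x x
  Adj-irrefl {x} xx = contradiction (trans (sym xx) (proj₂ simple x)) λ ()

  module-adj : y ∉ M → x ∈ M → w ∈ M → Adj G x y → Adj G w y
  module-adj {y} {x} {w} y∉M x∈M w∈M xy with proj₂ M-module y ∈⊤ y∉M
  ... | inj₁ adjacent-to-all  = adjacent-to-all w w∈M
  ... | inj₂ adjacent-to-none = contradiction (trans (sym xy) (adjacent-to-none x x∈M)) λ ()

  ∈Nbhd⁺ : x ∈ M → Adj G x y → y ∈ Nbhd G M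
  ∈Nbhd⁺ {x} {y} x∈M xy = lookup⇒[]= y (Nbhd G M) (begin
    lookup (Nbhd G M) y                                  ≡⟨ lookup∘tabulate _ y ⟩
    lookup ⊤ y ∧ anyᵇ {n} (λ x′ → lookup M x′ ∧ a x′ y)  ≡⟨ cong₂ _∧_ (lookup-replicate y true) (anyᵇ⁺ {n} x Mx∧xy) ⟩
    true                                                 ∎)
    where
    open ≡-Reasoning
    Mx∧xy : lookup M x ∧ a x y ≡ true
    Mx∧xy = cong₂ _∧_ ([]=⇒lookup x∈M) xy

  ∈Nbhd⁻ : y ∈ Nbhd G M → ∃ λ x → x ∈ M × Adj G x y
  ∈Nbhd⁻ {y} y∈N =
    let (x , Mx∧xy) = anyᵇ⁻ {n} (∧-conicalʳ _ _ (trans (sym (lookup∘tabulate _ y)) ([]=⇒lookup y∈N)))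
    in x , lookup⇒[]= x M (∧-conicalˡ _ _ Mx∧xy) , ∧-conicalʳ _ _ Mx∧xy

  ∈N∖M⁺ : x ∈ M → y ∉ M → Adj G x y → y ∈ N∖M
  ∈N∖M⁺ x∈M y∉M xy = x∈p∧x∉q⇒x∈p─q (∈Nbhd⁺ x∈M xy) y∉M

  ∈N∖M⁻ : y ∈ N∖M → y ∉ M × (∀ {x} → x ∈ M → Adj G x y)
  ∈N∖M⁻ y∈N∖M =
    let (x , x∈M , xy) = ∈Nbhd⁻ (p─q⊆p _ _ y∈N∖M)
        y∉M = x∈p─q⇒x∉q y∈N∖M
    in y∉M , λ x′∈M → module-adj y∉M x∈M x′∈M xy

  data Crossing (x y : Fin n) : Set where
    inside   : x ∈ M → y ∈ M → Crossing x y
    outside  : x ∉ M → y ∉ M → Crossing x y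
    entering : x ∉ M → y ∈ M → Crossing x y
    leaving  : x ∈ M → y ∉ M → Crossing x y

  crossing : ∀ x y → Crossing x y
  crossing x y with x ∈? M | y ∈? M
  ... | yes x∈M | yes y∈M = inside x∈M y∈M
  ... | no x∉M  | no y∉M  = outside x∉M y∉M
  ... | no x∉M  | yes y∈M = entering x∉M y∈M
  ... | yes x∈M | no y∉M  = leaving x∈M y∉M

  -- x sees y ∈ M, hence all of M, so no token of A lies in M.
  entering-∩ : Independent G A → Swap A B x y → Adj G x y → x ∉ M → y ∈ M →
               M ∩ A ≡ ⊥ × M ∩ B ≡ ⁅ y ⁆
  entering-∩ {A = A} iA s xy x∉M y∈M = M∩A≡⊥ , Swap-∩-entering s y∈M M∩A≡⊥
    where
    M∩A≡⊥ : M ∩ A ≡ ⊥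
    M∩A≡⊥ = Empty-unique λ (z , z∈M∩A) → let (z∈M , z∈A) = x∈p∩q⁻ _ _ z∈M∩A in
      nonadjacent iA z∈A (Swap.x∈A s) (module-adj x∉M y∈M z∈M (Adj-sym xy))

  leaving-∩ : ∣ M ∩ A ∣ ≤ 1 → Swap A B x y → x ∈ M → y ∉ M → M ∩ A ≡ ⁅ x ⁆ × M ∩ B ≡ ⊥
  leaving-∩ {A = A} {x = x} ∣M∩A∣≤1 s x∈M y∉M = M∩A≡x , Swap-∩-leaving s y∉M M∩A≡x
    where
    M∩A≡x : M ∩ A ≡ ⁅ x ⁆
    M∩A≡x = ∣p∣≤1⇒p≡⁅x⁆ ∣M∩A∣≤1 (x∈p∩q⁺ (x∈M , Swap.x∈A s))

  step-∣M∩∣≤1 : Independent G A → ∣ M ∩ A ∣ ≤ 1 → TSAdj G A B → ∣ M ∩ B ∣ ≤ 1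
  step-∣M∩∣≤1 iA ∣M∩A∣≤1 t with TSAdj⇒Swap {G = G} t
  ... | x , y , s , xy with crossing x y
  ...   | inside x∈M y∈M   = subst (_≤ 1) (Swap-∣∣ (Swap-∩ s x∈M y∈M)) ∣M∩A∣≤1
  ...   | outside x∉M y∉M  = subst (λ P → ∣ P ∣ ≤ 1) (Swap⇒∩≡ s x∉M y∉M) ∣M∩A∣≤1
  ...   | entering x∉M y∈M = ≤-reflexive (p≡⁅x⁆⇒∣p∣≡1 (proj₂ (entering-∩ iA s xy x∉M y∈M)))
  ...   | leaving x∈M y∉M  = subst (_≤ 1) (sym (p≡⊥⇒∣p∣≡0 (proj₂ (leaving-∩ ∣M∩A∣≤1 s x∈M y∉M)))) z≤n

  step-∣M∩∣ : Independent G A → Independent G B → 2 ≤ ∣ M ∩ A ∣ → TSAdj G A B →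
              ∣ M ∩ A ∣ ≡ ∣ M ∩ B ∣
  step-∣M∩∣ iA iB 2≤∣M∩A∣ t with TSAdj⇒Swap {G = G} t
  ... | x , y , s , xy with crossing x y
  ...   | inside x∈M y∈M   = Swap-∣∣ (Swap-∩ s x∈M y∈M)
  ...   | outside x∉M y∉M  = cong ∣_∣ (Swap⇒∩≡ s x∉M y∉M)
  ...   | entering x∉M y∈M =
    contradiction (subst (2 ≤_) (p≡⊥⇒∣p∣≡0 (proj₁ (entering-∩ iA s xy x∉M y∈M))) 2≤∣M∩A∣) λ ()
  ...   | leaving x∈M y∉M  =
    contradiction (subst (2 ≤_) (p≡⁅x⁆⇒∣p∣≡1 (proj₂ (entering-∩ iB (Swap-sym s) (Adj-sym xy) y∉M x∈M))) 2≤∣M∩A∣)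
                  λ { (s≤s ()) }

  reach-∣M∩∣≤1 : TSReach G A C → ∣ M ∩ A ∣ ≤ 1 → ∣ M ∩ C ∣ ≤ 1
  reach-∣M∩∣≤1 (done _)      ∣M∩A∣≤1 = ∣M∩A∣≤1
  reach-∣M∩∣≤1 (step iA t r) ∣M∩A∣≤1 = reach-∣M∩∣≤1 r (step-∣M∩∣≤1 iA ∣M∩A∣≤1 t)

  reach-∣M∩∣ : TSReach G A C → 2 ≤ ∣ M ∩ A ∣ → ∣ M ∩ A ∣ ≡ ∣ M ∩ C ∣
  reach-∣M∩∣ (done _)      _       = refl
  reach-∣M∩∣ {A = A} (step {B = B} iA t r) 2≤∣M∩A∣ = trans same (reach-∣M∩∣ r (subst (2 ≤_) same 2≤∣M∩A∣))
    where
    same : ∣ M ∩ A ∣ ≡ ∣ M ∩ B ∣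
    same = step-∣M∩∣ iA (TSReach-independent r) 2≤∣M∩A∣ t

  Independent-deleteV-N∖M : Independent G A → 0 < ∣ M ∩ A ∣ → Independent (deleteV G N∖M) A
  Independent-deleteV-N∖M iA 0<∣M∩A∣ = Independent-deleteV iA λ z∈A z∈N∖M →
    let (w , w∈M∩A)  = 0<∣p∣⇒Nonempty 0<∣M∩A∣
        (w∈M , w∈A) = x∈p∩q⁻ _ _ w∈M∩A
    in nonadjacent iA w∈A z∈A (proj₂ (∈N∖M⁻ z∈N∖M) w∈M)

  reach⇒reach-deleteV : TSReach G A C → 2 ≤ ∣ M ∩ A ∣ → TSReach (deleteV G N∖M) A C
  reach⇒reach-deleteV (done iA) 2≤∣M∩A∣ = done (Independent-deleteV-N∖M iA (≤-trans (s≤s z≤n) 2≤∣M∩A∣))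
  reach⇒reach-deleteV (step iA t r) 2≤∣M∩A∣ =
    step (Independent-deleteV-N∖M iA (≤-trans (s≤s z≤n) 2≤∣M∩A∣)) t
         (reach⇒reach-deleteV r (subst (2 ≤_) (step-∣M∩∣ iA (TSReach-independent r) 2≤∣M∩A∣ t) 2≤∣M∩A∣))

  suc∈contractSet⁺ : z ∈ A → z ∉ M → suc z ∈ contractSet M A
  suc∈contractSet⁺ z∈A z∉M = there (x∈p∧x∉q⇒x∈p─q z∈A z∉M)

  suc∈contractSet⁻ : suc z ∈ contractSet M A → z ∈ A × z ∉ M
  suc∈contractSet⁻ z∈ = p─q⊆p _ _ (drop-there z∈) , x∈p─q⇒x∉q (drop-there z∈)

  zero∈contractSet : M ∩ A ≡ ⁅ w ⁆ → zero ∈ contractSet M A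
  zero∈contractSet {A} {w} M∩A≡w rewrite ∩-comm A M | M∩A≡w | ∣⁅x⁆∣≡1 w = here

  zero∉contractSet : M ∩ A ≡ ⊥ → zero ∉ contractSet M A
  zero∉contractSet {A} M∩A≡⊥ rewrite ∩-comm A M | M∩A≡⊥ | ∣⊥∣≡0 n = λ ()

  zero∈contractSet⁻ : ∣ M ∩ A ∣ ≤ 1 → zero ∈ contractSet M A → ∃ λ w → M ∩ A ≡ ⁅ w ⁆
  zero∈contractSet⁻ ∣M∩A∣≤1 0∈ with ∣p∣≤1⇒p≡⊥⊎p≡⁅x⁆ ∣M∩A∣≤1
  ... | inj₁ M∩A≡⊥ = contradiction 0∈ (zero∉contractSet M∩A≡⊥)
  ... | inj₂ token = token

  zero∉contractSet⁻ : ∣ M ∩ A ∣ ≤ 1 → zero ∉ contractSet M A → M ∩ A ≡ ⊥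
  zero∉contractSet⁻ ∣M∩A∣≤1 0∉ with ∣p∣≤1⇒p≡⊥⊎p≡⁅x⁆ ∣M∩A∣≤1
  ... | inj₁ M∩A≡⊥       = M∩A≡⊥
  ... | inj₂ (_ , M∩A≡w) = contradiction (zero∈contractSet M∩A≡w) 0∉

  contract-adj⁺ : y ∈ N∖M → Adj G′ zero (suc y)
  contract-adj⁺ {y} y∈N∖M =
    cong₂ (λ b c → b ∧ not c) ([]=⇒lookup (p─q⊆p _ _ y∈N∖M)) (¬-not (x∈p─q⇒x∉q y∈N∖M ∘ lookup⇒[]= y M))

  contract-adj⁻ : Adj G′ zero (suc y) → y ∈ N∖M
  contract-adj⁻ {y} adj = x∈p∧x∉q⇒x∈p─q (lookup⇒[]= y _ (∧-conicalˡ _ _ adj)) λ y∈M →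
    contradiction (trans (cong not (sym ([]=⇒lookup y∈M))) (∧-conicalʳ _ _ adj)) λ ()

  contract-independent : Independent G A → ∣ M ∩ A ∣ ≤ 1 → Independent G′ (contractSet M A)
  contract-independent {A} iA ∣M∩A∣≤1 = ⊆V′ , nonadj
    where
    ⊆V′ : contractSet M A ⊆ V G′
    ⊆V′ {zero}  _  = here
    ⊆V′ {suc z} z∈ = there (x∈p∧x∉q⇒x∈p─q ∈⊤ (proj₂ (suc∈contractSet⁻ z∈)))
    token-nonadj : ∀ {y} → zero ∈ contractSet M A → suc y ∈ contractSet M A → ¬ Adj G′ zero (suc y)
    token-nonadj 0∈ y∈ adj′ =
      let (w , M∩A≡w)  = zero∈contractSet⁻ ∣M∩A∣≤1 0∈
          (w∈M , w∈A) = x∈p∩q⁻ _ _ (∈-≡⁅x⁆ M∩A≡w)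
      in nonadjacent iA w∈A (proj₁ (suc∈contractSet⁻ y∈)) (proj₂ (∈N∖M⁻ (contract-adj⁻ adj′)) w∈M)
    nonadj : ∀ x y → x ∈ contractSet M A → y ∈ contractSet M A → ¬ Adj G′ x y
    nonadj zero    zero    _  _  ()
    nonadj zero    (suc y) 0∈ y∈ = token-nonadj 0∈ y∈
    nonadj (suc x) zero    x∈ 0∈ = token-nonadj 0∈ x∈
    nonadj (suc x) (suc y) x∈ y∈ = nonadjacent iA (proj₁ (suc∈contractSet⁻ x∈)) (proj₁ (suc∈contractSet⁻ y∈))

  lift-independent : Independent G′ (contractSet M B) → ∣ M ∩ B ∣ ≤ 1 → Independent G B
  lift-independent {B} iB′ ∣M∩B∣≤1 = (λ _ → ∈⊤) , nonadj
    where
    token-nonadj : ∀ {w z} → w ∈ B → w ∈ M → z ∈ B → z ∉ M → ¬ Adj G w z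
    token-nonadj w∈B w∈M z∈B z∉M wz =
      nonadjacent iB′ (zero∈contractSet (∣p∣≤1⇒p≡⁅x⁆ ∣M∩B∣≤1 (x∈p∩q⁺ (w∈M , w∈B)))) (suc∈contractSet⁺ z∈B z∉M)
                  (contract-adj⁺ (∈N∖M⁺ w∈M z∉M wz))
    nonadj : ∀ x y → x ∈ B → y ∈ B → ¬ Adj G x y
    nonadj x y x∈B y∈B xy with crossing x y
    ... | inside x∈M y∈M   = Adj-irrefl (subst (Adj G x) y≡x xy)
      where
      y≡x : y ≡ x
      y≡x = x∈⁅y⁆⇒x≡y x (subst (y ∈_) (∣p∣≤1⇒p≡⁅x⁆ ∣M∩B∣≤1 (x∈p∩q⁺ (x∈M , x∈B))) (x∈p∩q⁺ (y∈M , y∈B)))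
    ... | outside x∉M y∉M  = nonadjacent iB′ (suc∈contractSet⁺ x∈B x∉M) (suc∈contractSet⁺ y∈B y∉M) xy
    ... | leaving x∈M y∉M  = token-nonadj x∈B x∈M y∈B y∉M xy
    ... | entering x∉M y∈M = token-nonadj y∈B y∈M x∈B x∉M (Adj-sym xy)

  contractSet-inside : Swap A B x y → x ∈ M → y ∈ M → contractSet M A ≡ contractSet M B
  contractSet-inside {A} {B} s x∈M y∈M rewrite ∩-comm A M | ∩-comm B M =
    cong₂ _∷_ (cong (_≡ᵇ 1) (Swap-∣∣ (Swap-∩ s x∈M y∈M))) (Swap⇒─≡ s x∈M y∈M)

  contractSet-Swap-outside : Swap A B x y → x ∉ M → y ∉ M →
                             Swap (contractSet M A) (contractSet M B) (suc x) (suc y)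
  contractSet-Swap-outside {A} {B} s x∉M y∉M rewrite ∩-comm A M | ∩-comm B M | Swap⇒∩≡ s x∉M y∉M =
    Swap-∷ (Swap-─ s x∉M y∉M)

  contractSet-Swap-entering : Swap A B x y → x ∉ M → y ∈ M → M ∩ A ≡ ⊥ → M ∩ B ≡ ⁅ y ⁆ →
                              Swap (contractSet M A) (contractSet M B) (suc x) zero
  contractSet-Swap-entering {A} {B} {x} s x∉M y∈M M∩A≡⊥ M∩B≡y = record
    { x∈A   = suc∈contractSet⁺ x∈A x∉M
    ; x∉B   = x∉B ∘ proj₁ ∘ suc∈contractSet⁻
    ; y∈B   = zero∈contractSet M∩B≡y
    ; y∉A   = zero∉contractSet M∩A≡⊥
    ; A-x⊆B = kept
    ; B-y⊆A = kept⁻ }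
    where
    open Swap s
    kept : ∀ {z} → z ∈ contractSet M A → z ≢ suc x → z ∈ contractSet M B
    kept {zero}  0∈ _   = contradiction 0∈ (zero∉contractSet M∩A≡⊥)
    kept {suc z} z∈ z≢x = let (z∈A , z∉M) = suc∈contractSet⁻ z∈ in
      suc∈contractSet⁺ (A-x⊆B z∈A (z≢x ∘ cong suc)) z∉M
    kept⁻ : ∀ {z} → z ∈ contractSet M B → z ≢ zero → z ∈ contractSet M A
    kept⁻ {zero}  _  z≢0 = contradiction refl z≢0
    kept⁻ {suc z} z∈ _   = let (z∈B , z∉M) = suc∈contractSet⁻ z∈ in
      suc∈contractSet⁺ (B-y⊆A z∈B λ { refl → z∉M y∈M }) z∉M

  contractSet-Swap-leaving : Swap A B x y → x ∈ M → y ∉ M → M ∩ A ≡ ⁅ x ⁆ → M ∩ B ≡ ⊥ →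
                             Swap (contractSet M A) (contractSet M B) zero (suc y)
  contractSet-Swap-leaving s x∈M y∉M M∩A≡x M∩B≡⊥ =
    Swap-sym (contractSet-Swap-entering (Swap-sym s) y∉M x∈M M∩B≡⊥ M∩A≡x)

  contract-step : Independent G A → ∣ M ∩ A ∣ ≤ 1 → TSAdj G A B →
                  contractSet M A ≡ contractSet M B ⊎ TSAdj G′ (contractSet M A) (contractSet M B)
  contract-step iA ∣M∩A∣≤1 t with TSAdj⇒Swap {G = G} t
  ... | x , y , s , xy with crossing x y
  ...   | inside x∈M y∈M   = inj₁ (contractSet-inside s x∈M y∈M)
  ...   | outside x∉M y∉M  = inj₂ (Swap⇒TSAdj {G = G′} (contractSet-Swap-outside s x∉M y∉M) xy)
  ...   | entering x∉M y∈M =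
    let (M∩A≡⊥ , M∩B≡y) = entering-∩ iA s xy x∉M y∈M in
    inj₂ (Swap⇒TSAdj {G = G′} (contractSet-Swap-entering s x∉M y∈M M∩A≡⊥ M∩B≡y)
                               (contract-adj⁺ (∈N∖M⁺ y∈M x∉M (Adj-sym xy))))
  ...   | leaving x∈M y∉M  =
    let (M∩A≡x , M∩B≡⊥) = leaving-∩ ∣M∩A∣≤1 s x∈M y∉M in
    inj₂ (Swap⇒TSAdj {G = G′} (contractSet-Swap-leaving s x∈M y∉M M∩A≡x M∩B≡⊥)
                               (contract-adj⁺ (∈N∖M⁺ x∈M y∉M xy)))

  reach⇒reach-contract : TSReach G A C → ∣ M ∩ A ∣ ≤ 1 → TSReach G′ (contractSet M A) (contractSet M C)
  reach⇒reach-contract (done iA) ∣M∩A∣≤1 = done (contract-independent iA ∣M∩A∣≤1)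
  reach⇒reach-contract {C = C} (step iA t r) ∣M∩A∣≤1 with contract-step iA ∣M∩A∣≤1 t
  ... | inj₁ same = subst (λ P → TSReach G′ P (contractSet M C)) (sym same)
                          (reach⇒reach-contract r (step-∣M∩∣≤1 iA ∣M∩A∣≤1 t))
  ... | inj₂ t′   = step (contract-independent iA ∣M∩A∣≤1) t′
                         (reach⇒reach-contract r (step-∣M∩∣≤1 iA ∣M∩A∣≤1 t))

  -- A move inside M leaves the contracted set unchanged, so independence transfers through G′.
  slide : PathIn G M w z → Independent G A → M ∩ A ≡ ⁅ w ⁆ → M ∩ C ≡ ⁅ z ⁆ → A ─ M ≡ C ─ M →
          TSReach G A C
  slide {A = A} (here _) iA M∩A≡w M∩C≡w A─M≡C─M =
    subst (TSReach G A) (∩-─-ext (trans M∩A≡w (sym M∩C≡w)) A─M≡C─M) (done iA)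
  slide {w = w} {A = A} (there {w = w′} w∈M ww′ p) iA M∩A≡w M∩C≡z A─M≡C─M =
    step iA (Swap⇒TSAdj {G = G} s ww′)
         (slide p iB M∩B≡w′ M∩C≡z (trans (sym (Swap⇒─≡ s w∈M w′∈M)) A─M≡C─M))
    where
    w′∈M : w′ ∈ M
    w′∈M = PathIn-start p
    w′∉A : w′ ∉ A
    w′∉A w′∈A = Adj-irrefl (subst (Adj G w) w′≡w ww′)
      where w′≡w = x∈⁅y⁆⇒x≡y w (subst (w′ ∈_) M∩A≡w (x∈p∩q⁺ (w′∈M , w′∈A)))
    s : Swap A (swap A w w′) w w′
    s = swap-Swap (proj₂ (x∈p∩q⁻ _ _ (∈-≡⁅x⁆ M∩A≡w))) w′∉A
    M∩B≡w′ : M ∩ swap A w w′ ≡ ⁅ w′ ⁆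
    M∩B≡w′ = Swap-⁅⁆ (Swap-∩ s w∈M w′∈M) M∩A≡w
    iB : Independent G (swap A w w′)
    iB = lift-independent (subst (Independent G′) (contractSet-inside s w∈M w′∈M)
                                 (contract-independent iA (≤-reflexive (p≡⁅x⁆⇒∣p∣≡1 M∩A≡w))))
                          (≤-reflexive (p≡⁅x⁆⇒∣p∣≡1 M∩B≡w′))

  Linked : Subset n → Subset n → Set
  Linked A J = ∀ {w v} → w ∈ M ∩ A → v ∈ M ∩ J → PathIn G M w v

  -- Tokens entering M are placed at t, which must be linked to the token of J in M (if any).
  module Lift (J : Subset n) (∣M∩J∣≤1 : ∣ M ∩ J ∣ ≤ 1)
              (t : Fin n) (t∈M : t ∈ M) (t⇝J : ∀ {v} → v ∈ M ∩ J → PathIn G M t v) where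

    record LiftedStep (A : Subset n) (B′ : Subset (suc n)) : Set where
      field
        lifted    : Subset n
        moves     : TSAdj G A lifted
        contracts : contractSet M lifted ≡ B′
        linked    : Linked lifted J

    private variable
      B′ : Subset (suc n)

    lift-outside : Linked A J → x ∈ A × x ∉ M → y ∉ M → Swap (contractSet M A) B′ (suc x) (suc y) →
                   Adj G x y → LiftedStep A B′
    lift-outside {A} {x} {y} linkedA (x∈A , x∉M) y∉M s′ xy = record
      { lifted    = swap A x y
      ; moves     = Swap⇒TSAdj {G = G} s xy
      ; contracts = Swap-unique (contractSet-Swap-outside s x∉M y∉M) s′
      ; linked    = λ w∈ → linkedA (subst (_ ∈_) (sym (Swap⇒∩≡ s x∉M y∉M)) w∈) }
      where
      s : Swap A (swap A x y) x y
      s = swap-Swap x∈A (λ y∈A → Swap.y∉A s′ (suc∈contractSet⁺ y∈A y∉M))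

    lift-leaving : (∃ λ w → M ∩ A ≡ ⁅ w ⁆) → y ∈ N∖M → Swap (contractSet M A) B′ zero (suc y) →
                   LiftedStep A B′
    lift-leaving {A} {y} (w , M∩A≡w) y∈N∖M s′ = record
      { lifted    = swap A w y
      ; moves     = Swap⇒TSAdj {G = G} s (proj₂ (∈N∖M⁻ y∈N∖M) w∈M)
      ; contracts = Swap-unique (contractSet-Swap-leaving s w∈M y∉M M∩A≡w M∩B≡⊥) s′
      ; linked    = λ w∈ → contradiction (subst (_ ∈_) M∩B≡⊥ w∈) ∉⊥ }
      where
      w∈M : w ∈ M
      w∈M = proj₁ (x∈p∩q⁻ _ _ (∈-≡⁅x⁆ M∩A≡w))
      y∉M : y ∉ M
      y∉M = proj₁ (∈N∖M⁻ y∈N∖M)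
      s : Swap A (swap A w y) w y
      s = swap-Swap (proj₂ (x∈p∩q⁻ _ _ (∈-≡⁅x⁆ M∩A≡w))) (λ y∈A → Swap.y∉A s′ (suc∈contractSet⁺ y∈A y∉M))
      M∩B≡⊥ : M ∩ swap A w y ≡ ⊥
      M∩B≡⊥ = Swap-∩-leaving s y∉M M∩A≡w

    lift-entering : x ∈ A × x ∉ M → M ∩ A ≡ ⊥ → x ∈ N∖M → Swap (contractSet M A) B′ (suc x) zero →
                    LiftedStep A B′
    lift-entering {x} {A} (x∈A , x∉M) M∩A≡⊥ x∈N∖M s′ = record
      { lifted    = swap A x t
      ; moves     = Swap⇒TSAdj {G = G} s (Adj-sym (proj₂ (∈N∖M⁻ x∈N∖M) t∈M))
      ; contracts = Swap-unique (contractSet-Swap-entering s x∉M t∈M M∩A≡⊥ M∩B≡t) s′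
      ; linked    = λ w∈ v∈ → subst (λ u → PathIn G M u _) (sym (x∈⁅y⁆⇒x≡y t (subst (_ ∈_) M∩B≡t w∈)))
                                    (t⇝J v∈) }
      where
      s : Swap A (swap A x t) x t
      s = swap-Swap x∈A (λ t∈A → ∉⊥ (subst (t ∈_) M∩A≡⊥ (x∈p∩q⁺ (t∈M , t∈A))))
      M∩B≡t : M ∩ swap A x t ≡ ⁅ t ⁆
      M∩B≡t = Swap-∩-entering s t∈M M∩A≡⊥

    lift-step : ∣ M ∩ A ∣ ≤ 1 → Linked A J → Independent G′ B′ → TSAdj G′ (contractSet M A) B′ →
                LiftedStep A B′
    lift-step ∣M∩A∣≤1 linkedA iB′ t′ with TSAdj⇒Swap {G = G′} t′
    ... | zero  , zero  , _  , ()
    ... | suc x , suc y , s′ , xy   =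
      lift-outside linkedA (suc∈contractSet⁻ (Swap.x∈A s′))
                   (x∈p─q⇒x∉q (drop-there (proj₁ iB′ (Swap.y∈B s′)))) s′ xy
    ... | zero  , suc y , s′ , adj′ =
      lift-leaving (zero∈contractSet⁻ ∣M∩A∣≤1 (Swap.x∈A s′)) (contract-adj⁻ adj′) s′
    ... | suc x , zero  , s′ , adj′ =
      lift-entering (suc∈contractSet⁻ (Swap.x∈A s′)) (zero∉contractSet⁻ ∣M∩A∣≤1 (Swap.y∉A s′))
                    (contract-adj⁻ adj′) s′

    lift-done : Independent G A → ∣ M ∩ A ∣ ≤ 1 → Linked A J → contractSet M A ≡ contractSet M J →
                TSReach G A J
    lift-done {A} iA ∣M∩A∣≤1 linkedA A↓≡J↓ with ∣p∣≤1⇒p≡⊥⊎p≡⁅x⁆ ∣M∩A∣≤1 | ∣p∣≤1⇒p≡⊥⊎p≡⁅x⁆ ∣M∩J∣≤1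
    ... | inj₁ M∩A≡⊥ | inj₁ M∩J≡⊥ =
      subst (TSReach G A) (∩-─-ext (trans M∩A≡⊥ (sym M∩J≡⊥)) (∷-injectiveʳ A↓≡J↓)) (done iA)
    ... | inj₂ (w , M∩A≡w) | inj₂ (v , M∩J≡v) =
      slide (linkedA (∈-≡⁅x⁆ M∩A≡w) (∈-≡⁅x⁆ M∩J≡v)) iA M∩A≡w M∩J≡v (∷-injectiveʳ A↓≡J↓)
    ... | inj₁ M∩A≡⊥ | inj₂ (_ , M∩J≡v) =
      contradiction (subst (zero ∈_) (sym A↓≡J↓) (zero∈contractSet M∩J≡v)) (zero∉contractSet M∩A≡⊥)
    ... | inj₂ (_ , M∩A≡w) | inj₁ M∩J≡⊥ =
      contradiction (subst (zero ∈_) A↓≡J↓ (zero∈contractSet M∩A≡w)) (zero∉contractSet M∩J≡⊥)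

    lift : ∀ {A′} → TSReach G′ A′ (contractSet M J) →
           ∀ {A} → contractSet M A ≡ A′ → Independent G A → ∣ M ∩ A ∣ ≤ 1 → Linked A J → TSReach G A J
    lift (done _)       A↓≡J↓ iA ∣M∩A∣≤1 linkedA = lift-done iA ∣M∩A∣≤1 linkedA A↓≡J↓
    lift (step _ t′ r)  refl  iA ∣M∩A∣≤1 linkedA = step iA moves (lift r contracts iB ∣M∩B∣≤1 linked)
      where
      open LiftedStep (lift-step ∣M∩A∣≤1 linkedA (TSReach-independent r) t′)
      ∣M∩B∣≤1 : ∣ M ∩ lifted ∣ ≤ 1
      ∣M∩B∣≤1 = step-∣M∩∣≤1 iA ∣M∩A∣≤1 moves
      iB : Independent G lifted
      iB = lift-independent (subst (Independent G′) (sym contracts) (TSReach-independent r)) ∣M∩B∣≤1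

  reach-contract⇒reach : Nonempty M → ∣ M ∩ C ∣ ≤ 1 → Independent G A → ∣ M ∩ A ∣ ≤ 1 → Linked A C →
                         TSReach G′ (contractSet M A) (contractSet M C) → TSReach G A C
  reach-contract⇒reach {C} (m , m∈M) ∣M∩C∣≤1 iA ∣M∩A∣≤1 linkedA r′ with ∣p∣≤1⇒p≡⊥⊎p≡⁅x⁆ ∣M∩C∣≤1
  ... | inj₁ M∩C≡⊥ =
    Lift.lift C ∣M∩C∣≤1 m m∈M (λ v∈ → contradiction (subst (_ ∈_) M∩C≡⊥ v∈) ∉⊥) r′ refl iA ∣M∩A∣≤1 linkedA
  ... | inj₂ (v , M∩C≡v) =
    Lift.lift C ∣M∩C∣≤1 v v∈M v⇝C r′ refl iA ∣M∩A∣≤1 linkedA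
    where
    v∈M : v ∈ M
    v∈M = proj₁ (x∈p∩q⁻ _ _ (∈-≡⁅x⁆ M∩C≡v))
    v⇝C : ∀ {v′} → v′ ∈ M ∩ C → PathIn G M v v′
    v⇝C v′∈ = subst (PathIn G M v) (sym (x∈⁅y⁆⇒x≡y v (subst (_ ∈_) M∩C≡v v′∈))) (here v∈M)

lemma6p4 : {n : ℕ} (G : Graph n) (I J M : Subset n) →
    V G ≡ ⊤ →
    Simple G → ForkFree G →
    Independent G I → Independent G J → ∣ I ∣ ≡ ∣ J ∣ →
    NoVertexSeesThree G I → NoSplitModule G I J →
    NonTrivialModule G M →
    ((∣ M ∩ I ∣ ≤ 1 → ∣ M ∩ J ∣ ≤ 1 →
        (TSReach G I J → TSReach (contract G M) (contractSet M I) (contractSet M J)) ×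
        (TSReach (contract G M) (contractSet M I) (contractSet M J) → TSReach G I J)) ×
     (∣ M ∩ I ∣ ≤ 1 → 2 ≤ ∣ M ∩ J ∣ → ¬ TSReach G I J)) ×
    ((2 ≤ ∣ M ∩ I ∣ → ∣ M ∩ J ∣ ≢ ∣ M ∩ I ∣ → ¬ TSReach G I J) ×
     (2 ≤ ∣ M ∩ I ∣ → ∣ M ∩ J ∣ ≡ ∣ M ∩ I ∣ →
        (TSReach G I J → TSReach (deleteV G (Nbhd G M ─ M)) I J) ×
        (TSReach (deleteV G (Nbhd G M ─ M)) I J → TSReach G I J)))
lemma6p4 (graph _ a) I J M refl simple _ iI _ _ _ noSplit M-nontrivial@(M-module , M≢∅ , _) =
    ( (λ ∣M∩I∣≤1 ∣M∩J∣≤1 → (λ r → reach⇒reach-contract r ∣M∩I∣≤1)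
                         , reach-contract⇒reach M≢∅ ∣M∩J∣≤1 iI ∣M∩I∣≤1 (linked ∣M∩I∣≤1 ∣M∩J∣≤1))
    , (λ ∣M∩I∣≤1 2≤∣M∩J∣ r → contradiction (≤-trans 2≤∣M∩J∣ (reach-∣M∩∣≤1 r ∣M∩I∣≤1)) λ { (s≤s ()) }) )
  , ( (λ 2≤∣M∩I∣ ∣M∩J∣≢∣M∩I∣ r → ∣M∩J∣≢∣M∩I∣ (sym (reach-∣M∩∣ r 2≤∣M∩I∣)))
    , (λ 2≤∣M∩I∣ _ → (λ r → reach⇒reach-deleteV r 2≤∣M∩I∣) , reach-deleteV⇒reach) )
  where
  open ModuleReconfiguration a simple M M-module
  linked : ∣ M ∩ I ∣ ≤ 1 → ∣ M ∩ J ∣ ≤ 1 → Linked I J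
  linked ∣M∩I∣≤1 ∣M∩J∣≤1 w∈ v∈ =
    PathIn-stable (noSplit M _ _ M-nontrivial (∣p∣≤1⇒p≡⁅x⁆ ∣M∩I∣≤1 w∈) (∣p∣≤1⇒p≡⁅x⁆ ∣M∩J∣≤1 v∈))
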